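{- Let $R$ be a right fountain triangulation of $\mathbb{N}$ with fountain point $0$, and let $(m_{a,b})_{0\le a\le b}$ be the right half-frieze from $R$. Then for $0\le a<b$, $m_{a,b}=1$ if and only if $(a,b)$ is an arc in $R$.
   Context: Arcs are pairs $(a,b)$ of integers with $0\le a<b$; arcs $(a,b),(c,d)$ cross if $a<c<b<d$ or $c<a<d<b$. A triangulation of $\mathbb{N}$ is a maximal set of pairwise noncrossing arcs (containing all $(a,a+1)$). A right fountain triangulation with fountain point $0$ is such a triangulation containing $(0,n)$ for infinitely many $n$. A right half-frieze (at $0$) is an array of positive integers $m_{a,b}$, $0\le a<b$, together with $m_{a,a}=0$, such that $m_{a,a+1}=1$ for all $a\ge0$ and $m_{a,b}m_{a+1,b+1}-m_{a+1,b}m_{a,b+1}=1$ for all $0\le a<b$; it is determined by its quiddity sequence $(m_{a,a+2})_{a\ge0}$. The right half-frieze from $R$ is the one with quiddity sequence $m_{a,a+2}=$ the number of triangles of $R$ having $a+1$ as a vertex. -}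

module Defs where

open import Level using (Level; suc; _⊔_)
open import Data.Nat using (ℕ; _+_; _*_; _<_; _≤_)
open import Data.Product using (Σ; _×_; _,_; ∃-syntax)
open import Data.Sum using (_⊎_)
open import Data.List using (List; length)
open import Data.List.Membership.Propositional using (_∈_)
open import Data.List.Relation.Unary.All using (All)
open import Data.List.Relation.Unary.Unique.Propositional using (Unique)
open import Relation.Binary.PropositionalEquality using (_≡_)
open import Relation.Nullary using (¬_)

Cross : ℕ → ℕ → ℕ → ℕ → Set
Cross a b c d = (a < c × c < b × b < d) ⊎ (c < a × a < d × d < b)

record Triangulation {ℓ : Level} (R : ℕ → ℕ → Set ℓ) : Set ℓ where
  field
    arc        : ∀ {a b} → R a b → a < b
    noncross   : ∀ {a b c d} → R a b → R c d → ¬ Cross a b c d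
    maximal    : ∀ a b → a < b → (∀ c d → R c d → ¬ Cross a b c d) → R a b
    contains-succ : ∀ a → R a (a + 1)

record RightFountain0 {ℓ : Level} (R : ℕ → ℕ → Set ℓ) : Set ℓ where
  field
    triangulation : Triangulation R
    fountain      : ∀ N → ∃[ n ] (N ≤ n × R 0 n)

IsTriangle : ∀ {ℓ} → (ℕ → ℕ → Set ℓ) → ℕ × ℕ × ℕ → Set ℓ
IsTriangle R (i , j , k) = i < j × j < k × R i j × R j k × R i k

HasVertex : ℕ → ℕ × ℕ × ℕ → Set
HasVertex v (i , j , k) = v ≡ i ⊎ v ≡ j ⊎ v ≡ k

TriangleCount : ∀ {ℓ} → (ℕ → ℕ → Set ℓ) → ℕ → ℕ → Set ℓ
TriangleCount R v n =
  Σ (List (ℕ × ℕ × ℕ)) λ L →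
    Unique L
    × All (λ t → IsTriangle R t × HasVertex v t) L
    × (∀ t → IsTriangle R t → HasVertex v t → t ∈ L)
    × length L ≡ n

-- A right half-frieze (at 0): m a b for 0 ≤ a ≤ b (values for a > b unused),
-- m a a = 0, m a (a+1) = 1, positive entries for a < b, and the
-- unimodular (diamond) rule written additively in ℕ.
record RightHalfFrieze (m : ℕ → ℕ → ℕ) : Set where
  field
    diag     : ∀ a → m a a ≡ 0
    off-diag : ∀ a → m a (a + 1) ≡ 1
    positive : ∀ a b → a < b → 0 < m a b
    diamond  : ∀ a b → a < b →
               m a b * m (a + 1) (b + 1) ≡ 1 + m (a + 1) b * m a (b + 1)

record HalfFriezeFrom {ℓ : Level} (R : ℕ → ℕ → Set ℓ) (m : ℕ → ℕ → ℕ) : Set ℓ where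
  field
    frieze   : RightHalfFrieze m
    quiddity : ∀ a → TriangleCount R (a + 1) (m a (a + 2))

-- Entries of a half-frieze satisfy the Ptolemy relations
-- m i k * m j l = m i j * m k l + m i l * m j k  (i ≤ j ≤ k ≤ l):
-- every row l ↦ m a l solves the recurrence f (l+2) + f l = m l (l+2) * f (l+1),
-- and both sides are solutions in l that agree at l = k and l = k+1.
-- Hence two entries equal to 1 never sit at crossing positions (Ptolemy would give 1 ≥ 2),
-- so by maximality of R every entry 1 is an arc, once every arc is known to carry a 1.
-- The latter is proved by induction on b ∸ a.  Let c be the apex of the triangle over
-- the arc (a , b).  The triangles at c are those ending at c, the triangle (a , c , b),
-- and those starting at c; peeling off apexes shows that the two fans have
-- m a (c-1) and m (c+1) b triangles, so m (c-1) (c+1) = m a (c-1) + 1 + m (c+1) b.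
-- The recurrence at c then gives m a (c+1) = 1 + m (c+1) b, and Ptolemy for a, c, c+1, b
-- turns this into m a b = 1.

module Submission where

open import Defs
open import Level using (Level; _⊔_; 0ℓ)
open import Data.Empty using (⊥-elim)
open import Data.List using (List; []; _∷_; _++_; length)
open import Data.List.Properties using (length-++)
open import Data.List.Membership.Propositional using (_∈_; find; lose)
open import Data.List.Membership.Propositional.Properties using (∈-++⁻; ∈-++⁺ˡ; ∈-++⁺ʳ)
open import Data.List.Membership.Propositional.Properties.WithK using (unique∧set⇒bag)
open import Data.List.Relation.Binary.BagAndSetEquality using (∼bag⇒↭)
open import Data.List.Relation.Binary.Permutation.Propositional.Properties using (↭-length)
import Data.List.Relation.Unary.All as All
open import Data.List.Relation.Unary.AllPairs using ([]; _∷_)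
open import Data.List.Relation.Unary.Any using (here; any?)
open import Data.List.Relation.Unary.Unique.Propositional using (Unique)
import Data.List.Relation.Unary.Unique.Propositional.Properties as Unique
open import Data.Nat using (ℕ; zero; suc; _+_; _*_; _∸_; _≤_; _<_; _≟_; _≤?_; s≤s; >-nonZero;
                            _≤′_; ≤′-refl; ≤′-step; _≤‴_; ≤‴-refl; ≤‴-step)
open import Data.Nat.Induction using (<-wellFounded)
open import Data.Nat.Properties
open import Data.Nat.Tactic.RingSolver using (solve)
open import Data.Product using (_×_; _,_; proj₁; proj₂; ∃-syntax; Σ-syntax)
open import Data.Sum as Sum using (inj₁; inj₂)
open import Function.Base using (_∘_)
open import Function.Bundles using (_⇔_; mk⇔)
open import Induction.WellFounded using (Acc; acc)
open import Relation.Binary.Definitions using (tri<; tri≈; tri>)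
open import Relation.Binary.PropositionalEquality
  using (_≡_; refl; sym; cong; cong₂; subst; subst₂; module ≡-Reasoning)
open import Relation.Nullary using (¬_; yes; no)
open import Relation.Nullary.Decidable using (_×-dec_)
open import Relation.Unary using (Pred; Decidable; _⊆_; _≐_; _∪_; _∩_; ｛_｝; Empty)
import Algebra.Properties.CommutativeSemigroup as CommutativeSemigroupProperties

private
  variable
    a ℓ₁ ℓ₂ : Level
    A : Set a
  module +-CS = CommutativeSemigroupProperties +-commutativeSemigroup
  module *-CS = CommutativeSemigroupProperties *-commutativeSemigroup

record Enumeration {A : Set a} (P : Pred A ℓ₁) : Set (a ⊔ ℓ₁) where
  field
    elements : List A
    unique   : Unique elements
    sound    : ∀ {x} → x ∈ elements → P x
    complete : ∀ {x} → P x → x ∈ elements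

  size : ℕ
  size = length elements

open Enumeration

module _ {P : Pred A ℓ₁} {Q : Pred A ℓ₂} where

  size-≐ : P ≐ Q → (e : Enumeration P) (f : Enumeration Q) → size e ≡ size f
  size-≐ (P⊆Q , Q⊆P) e f = ↭-length (∼bag⇒↭ (unique∧set⇒bag (unique e) (unique f)
    (mk⇔ (complete f ∘ P⊆Q ∘ sound e) (complete e ∘ Q⊆P ∘ sound f))))

  enumeration-≐ : P ≐ Q → Enumeration P → Enumeration Q
  enumeration-≐ (P⊆Q , Q⊆P) e = record
    { elements = elements e
    ; unique   = unique e
    ; sound    = P⊆Q ∘ sound e
    ; complete = complete e ∘ Q⊆P
    }

  enumeration-∪ : Empty (P ∩ Q) → Enumeration P → Enumeration Q → Enumeration (P ∪ Q)
  enumeration-∪ disjoint e f = record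
    { elements = elements e ++ elements f
    ; unique   = Unique.++⁺ (unique e) (unique f) λ (x∈e , x∈f) → disjoint _ (sound e x∈e , sound f x∈f)
    ; sound    = λ x∈ → Sum.map (sound e) (sound f) (∈-++⁻ (elements e) x∈)
    ; complete = Sum.[ ∈-++⁺ˡ ∘ complete e , ∈-++⁺ʳ (elements e) ∘ complete f ]
    }

enumeration-∅ : {P : Pred A ℓ₁} → Empty P → Enumeration P
enumeration-∅ empty = record
  { elements = [] ; unique = [] ; sound = λ () ; complete = λ {x} Px → ⊥-elim (empty x Px) }

enumeration-｛｝ : (x : A) → Enumeration ｛ x ｝
enumeration-｛｝ x = record
  { elements = x ∷ []
  ; unique   = All.[] ∷ []
  ; sound    = λ { (here refl) → refl }
  ; complete = λ { refl → here refl }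
  }

record Recurrence (q : ℕ → ℕ) (k : ℕ) (f : ℕ → ℕ) : Set where
  constructor recurrence
  field
    step : ∀ {l} → k ≤ l → f (suc (suc l)) + f l ≡ q l * f (suc l)

open Recurrence

module _ {q : ℕ → ℕ} {k : ℕ} where

  recurrence-mono : ∀ {k′ f} → k ≤ k′ → Recurrence q k f → Recurrence q k′ f
  recurrence-mono k≤k′ rec = recurrence λ k′≤l → step rec (≤-trans k≤k′ k′≤l)

  recurrence-scale : ∀ c {f} → Recurrence q k f → Recurrence q k (λ l → c * f l)
  recurrence-scale c {f} rec = recurrence λ {l} k≤l → begin
    c * f (suc (suc l)) + c * f l ≡⟨ *-distribˡ-+ c _ _ ⟨
    c * (f (suc (suc l)) + f l)   ≡⟨ cong (c *_) (step rec k≤l) ⟩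
    c * (q l * f (suc l))         ≡⟨ *-CS.x∙yz≈y∙xz c (q l) (f (suc l)) ⟩
    q l * (c * f (suc l))         ∎
    where open ≡-Reasoning

  recurrence-+ : ∀ {f g} → Recurrence q k f → Recurrence q k g → Recurrence q k (λ l → f l + g l)
  recurrence-+ {f} {g} recf recg = recurrence λ {l} k≤l → begin
    (f (suc (suc l)) + g (suc (suc l))) + (f l + g l)
      ≡⟨ +-CS.interchange (f (suc (suc l))) (g (suc (suc l))) (f l) (g l) ⟩
    (f (suc (suc l)) + f l) + (g (suc (suc l)) + g l)   ≡⟨ cong₂ _+_ (step recf k≤l) (step recg k≤l) ⟩
    q l * f (suc l) + q l * g (suc l)                   ≡⟨ *-distribˡ-+ (q l) _ _ ⟨
    q l * (f (suc l) + g (suc l))                       ∎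
    where open ≡-Reasoning

  recurrence-unique : ∀ {f g} → Recurrence q k f → Recurrence q k g →
                      f k ≡ g k → f (suc k) ≡ g (suc k) → ∀ {l} → k ≤ l → f l ≡ g l
  recurrence-unique {f} {g} recf recg eq₀ eq₁ k≤l = proj₁ (agree (≤⇒≤′ k≤l))
    where
    agree : ∀ {l} → k ≤′ l → f l ≡ g l × f (suc l) ≡ g (suc l)
    agree ≤′-refl = eq₀ , eq₁
    agree (≤′-step {l} k≤′l) with agree k≤′l
    ... | eqₗ , eqₗ₊₁ = eqₗ₊₁ , +-cancelʳ-≡ (f l) _ _ (begin
      f (suc (suc l)) + f l   ≡⟨ step recf (≤′⇒≤ k≤′l) ⟩
      q l * f (suc l)         ≡⟨ cong (q l *_) eqₗ₊₁ ⟩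
      q l * g (suc l)         ≡⟨ step recg (≤′⇒≤ k≤′l) ⟨
      g (suc (suc l)) + g l   ≡⟨ cong (g (suc (suc l)) +_) eqₗ ⟨
      g (suc (suc l)) + f l   ∎)
      where open ≡-Reasoning

  casoratian-invariant : ∀ {f g} c → Recurrence q k f → Recurrence q k g →
                         f k * g (suc k) ≡ c + f (suc k) * g k →
                         ∀ {l} → k ≤ l → f l * g (suc l) ≡ c + f (suc l) * g l
  casoratian-invariant {f} {g} c recf recg init k≤l = go (≤⇒≤′ k≤l)
    where
    go : ∀ {l} → k ≤′ l → f l * g (suc l) ≡ c + f (suc l) * g l
    go ≤′-refl               = init
    go (≤′-step {l} k≤′l) = +-cancelʳ-≡ (f (suc l) * g l) _ _ (begin
      f₁ * g₂ + f₁ * g₀       ≡⟨ *-distribˡ-+ f₁ g₂ g₀ ⟨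
      f₁ * (g₂ + g₀)          ≡⟨ cong (f₁ *_) (step recg (≤′⇒≤ k≤′l)) ⟩
      f₁ * (q l * g₁)         ≡⟨ *-CS.x∙yz≈yx∙z f₁ (q l) g₁ ⟩
      (q l * f₁) * g₁         ≡⟨ cong (_* g₁) (step recf (≤′⇒≤ k≤′l)) ⟨
      (f₂ + f₀) * g₁          ≡⟨ *-distribʳ-+ g₁ f₂ f₀ ⟩
      f₂ * g₁ + f₀ * g₁       ≡⟨ cong (f₂ * g₁ +_) (go k≤′l) ⟩
      f₂ * g₁ + (c + f₁ * g₀) ≡⟨ +-CS.x∙yz≈yx∙z (f₂ * g₁) c (f₁ * g₀) ⟩
      (c + f₂ * g₁) + f₁ * g₀ ∎)
      where
      open ≡-Reasoning
      f₀ f₁ f₂ g₀ g₁ g₂ : ℕ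
      f₀ = f l ; f₁ = f (suc l) ; f₂ = f (suc (suc l))
      g₀ = g l ; g₁ = g (suc l) ; g₂ = g (suc (suc l))

recurrence-transfer : ∀ (f g : ℕ → ℕ) {q l} → 0 < g (suc l) →
                      g (suc (suc l)) + g l ≡ q * g (suc l) →
                      f l * g (suc l) ≡ 1 + f (suc l) * g l →
                      f (suc l) * g (suc (suc l)) ≡ 1 + f (suc (suc l)) * g (suc l) →
                      f (suc (suc l)) + f l ≡ q * f (suc l)
recurrence-transfer f g {q} {l} 0<g₁ recg w₀ w₁ =
  *-cancelˡ-≡ _ _ (g (suc l)) {{>-nonZero 0<g₁}}
    (scaled-recurrence (f l) (f (suc l)) (f (suc (suc l))) (g l) (g (suc l)) (g (suc (suc l))) q recg w₀ w₁)
  where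
  scaled-recurrence : ∀ f₀ f₁ f₂ g₀ g₁ g₂ q → g₂ + g₀ ≡ q * g₁ →
             f₀ * g₁ ≡ 1 + f₁ * g₀ → f₁ * g₂ ≡ 1 + f₂ * g₁ → g₁ * (f₂ + f₀) ≡ g₁ * (q * f₁)
  scaled-recurrence f₀ f₁ f₂ g₀ g₁ g₂ q recg w₀ w₁ = suc-injective (begin
    suc (g₁ * (f₂ + f₀))        ≡⟨ solve (f₀ ∷ f₁ ∷ f₂ ∷ g₁ ∷ []) ⟩
    (1 + f₂ * g₁) + f₀ * g₁     ≡⟨ cong₂ _+_ (sym w₁) w₀ ⟩
    f₁ * g₂ + (1 + f₁ * g₀)     ≡⟨ solve (f₁ ∷ g₀ ∷ g₂ ∷ []) ⟩
    suc (f₁ * (g₂ + g₀))        ≡⟨ cong (λ x → suc (f₁ * x)) recg ⟩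
    suc (f₁ * (q * g₁))         ≡⟨ solve (f₁ ∷ q ∷ g₁ ∷ []) ⟩
    suc (g₁ * (q * f₁))         ∎)
    where open ≡-Reasoning

module RightHalfFriezeProperties {m : ℕ → ℕ → ℕ} (F : RightHalfFrieze m) where
  open RightHalfFrieze F

  m-suc : ∀ a → m a (suc a) ≡ 1
  m-suc a = subst (λ b → m a b ≡ 1) (+-comm a 1) (off-diag a)

  diamond-suc : ∀ {a b} → a < b → m a b * m (suc a) (suc b) ≡ 1 + m a (suc b) * m (suc a) b
  diamond-suc {a} {b} a<b = begin
    m a b * m (suc a) (suc b)      ≡⟨ subst₂ (λ a′ b′ → m a b * m a′ b′ ≡ 1 + m a′ b * m a b′)
                                        (+-comm a 1) (+-comm b 1) (diamond a b a<b) ⟩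
    1 + m (suc a) b * m a (suc b)  ≡⟨ cong suc (*-comm (m (suc a) b) (m a (suc b))) ⟩
    1 + m a (suc b) * m (suc a) b  ∎
    where open ≡-Reasoning

  quiddity : ℕ → ℕ
  quiddity l = m l (suc (suc l))

  -- The diamond rule says that consecutive rows have Casoratian 1, which carries the
  -- recurrence from row a + 1 down to row a.
  row-recurrence : ∀ a → Recurrence quiddity a (m a)
  row-recurrence a = recurrence λ {l} a≤l → go l (≤⇒≤‴ a≤l)
    where
    go : ∀ l {a} → a ≤‴ l → m a (suc (suc l)) + m a l ≡ quiddity l * m a (suc l)
    go l ≤‴-refl = begin
      quiddity l + m l l   ≡⟨ cong (quiddity l +_) (diag l) ⟩
      quiddity l + 0       ≡⟨ +-identityʳ _ ⟩
      quiddity l           ≡⟨ *-identityʳ _ ⟨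
      quiddity l * 1       ≡⟨ cong (quiddity l *_) (m-suc l) ⟨
      quiddity l * m l (suc l) ∎
      where open ≡-Reasoning
    go l {a} (≤‴-step a<‴l) = recurrence-transfer (m a) (m (suc a)) {quiddity l}
      (positive (suc a) (suc l) (s≤s a<l)) (go l a<‴l) (diamond-suc a<l) (diamond-suc (m<n⇒m<1+n a<l))
      where
      a<l : a < l
      a<l = ≤‴⇒≤ a<‴l

  row-casoratian : ∀ {i j l} → i ≤ j → j ≤ l → m i l * m j (suc l) ≡ m i j + m i (suc l) * m j l
  row-casoratian {i} {j} i≤j =
    casoratian-invariant (m i j) (recurrence-mono i≤j (row-recurrence i)) (row-recurrence j) (begin
      m i j * m j (suc j)         ≡⟨ cong (m i j *_) (m-suc j) ⟩
      m i j * 1                   ≡⟨ *-identityʳ _ ⟩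
      m i j                       ≡⟨ +-identityʳ _ ⟨
      m i j + 0                   ≡⟨ cong (m i j +_) (*-zeroʳ (m i (suc j))) ⟨
      m i j + m i (suc j) * 0     ≡⟨ cong (λ x → m i j + m i (suc j) * x) (diag j) ⟨
      m i j + m i (suc j) * m j j ∎)
    where open ≡-Reasoning

  ptolemy : ∀ {i j k l} → i ≤ j → j ≤ k → k ≤ l → m i k * m j l ≡ m i j * m k l + m i l * m j k
  ptolemy {i} {j} {k} {l} i≤j j≤k k≤l = begin
    m i k * m j l                  ≡⟨ recurrence-unique lhs-recurrence rhs-recurrence at-k at-suc-k k≤l ⟩
    m i j * m k l + m j k * m i l  ≡⟨ cong (m i j * m k l +_) (*-comm (m j k) (m i l)) ⟩
    m i j * m k l + m i l * m j k  ∎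
    where
    open ≡-Reasoning
    lhs-recurrence : Recurrence quiddity k (λ l → m i k * m j l)
    lhs-recurrence = recurrence-scale (m i k) (recurrence-mono j≤k (row-recurrence j))
    rhs-recurrence : Recurrence quiddity k (λ l → m i j * m k l + m j k * m i l)
    rhs-recurrence = recurrence-+ (recurrence-scale (m i j) (row-recurrence k))
      (recurrence-scale (m j k) (recurrence-mono (≤-trans i≤j j≤k) (row-recurrence i)))
    at-k : m i k * m j k ≡ m i j * m k k + m j k * m i k
    at-k = begin
      m i k * m j k                  ≡⟨ *-comm (m i k) (m j k) ⟩
      m j k * m i k                  ≡⟨ cong (_+ m j k * m i k) (*-zeroʳ (m i j)) ⟨
      m i j * 0 + m j k * m i k      ≡⟨ cong (λ x → m i j * x + m j k * m i k) (diag k) ⟨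
      m i j * m k k + m j k * m i k  ∎
    at-suc-k : m i k * m j (suc k) ≡ m i j * m k (suc k) + m j k * m i (suc k)
    at-suc-k = begin
      m i k * m j (suc k)                         ≡⟨ row-casoratian i≤j j≤k ⟩
      m i j + m i (suc k) * m j k
        ≡⟨ cong₂ _+_ (*-identityʳ (m i j)) (*-comm (m j k) (m i (suc k))) ⟨
      m i j * 1 + m j k * m i (suc k)             ≡⟨ cong (λ x → m i j * x + m j k * m i (suc k)) (m-suc k) ⟨
      m i j * m k (suc k) + m j k * m i (suc k)   ∎

  left-fan-step : ∀ {x d c} → x ≤ d → d ≤ c → m x d ≡ 1 → m d (suc c) ≡ 1 → m x (suc c) ≡ 1 →
                  m x c ≡ suc (m d c)
  left-fan-step {x} {d} {c} x≤d d≤c xd dc xc = begin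
    m x c                                      ≡⟨ *-identityʳ (m x c) ⟨
    m x c * 1                                  ≡⟨ cong (m x c *_) dc ⟨
    m x c * m d (suc c)                        ≡⟨ ptolemy x≤d d≤c (n≤1+n c) ⟩
    m x d * m c (suc c) + m x (suc c) * m d c  ≡⟨ cong₂ (λ u v → u * m c (suc c) + v * m d c) xd xc ⟩
    1 * m c (suc c) + 1 * m d c                ≡⟨ cong₂ _+_ (*-identityˡ (m c (suc c))) (*-identityˡ (m d c)) ⟩
    m c (suc c) + m d c                        ≡⟨ cong (_+ m d c) (m-suc c) ⟩
    suc (m d c)                                ∎
    where open ≡-Reasoning

  right-fan-step : ∀ {c e y} → c < e → e ≤ y → m c e ≡ 1 → m e y ≡ 1 → m c y ≡ 1 →
                   m (suc c) y ≡ suc (m (suc c) e)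
  right-fan-step {c} {e} {y} c<e e≤y ce ey cy = begin
    m (suc c) y                                      ≡⟨ *-identityˡ (m (suc c) y) ⟨
    1 * m (suc c) y                                  ≡⟨ cong (_* m (suc c) y) ce ⟨
    m c e * m (suc c) y                              ≡⟨ ptolemy (n≤1+n c) c<e e≤y ⟩
    m c (suc c) * m e y + m c y * m (suc c) e        ≡⟨ cong₂ (λ u v → u * v + m c y * m (suc c) e) (m-suc c) ey ⟩
    1 * 1 + m c y * m (suc c) e                      ≡⟨ cong (λ u → 1 + u * m (suc c) e) cy ⟩
    1 + 1 * m (suc c) e                              ≡⟨ cong suc (*-identityˡ (m (suc c) e)) ⟩
    suc (m (suc c) e)                                ∎
    where open ≡-Reasoning

  long-side-one : ∀ {a c b} → a ≤ c → suc c < b → m a (suc c) ≡ 1 → m (suc c) b ≡ 1 →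
                  quiddity c ≡ m a c + suc (m (suc (suc c)) b) → m a b ≡ 1
  long-side-one {a} {c} {b} a≤c c+1<b ac cb split = +-cancelˡ-≡ (m (suc (suc c)) b) _ _ (begin
    m (suc (suc c)) b + m a b    ≡⟨ apex-ptolemy ⟨
    m a (suc (suc c))            ≡⟨ +-cancelʳ-≡ (m a c) _ _ recurrence-at-c ⟩
    suc (m (suc (suc c)) b)      ≡⟨ +-comm 1 (m (suc (suc c)) b) ⟩
    m (suc (suc c)) b + 1        ∎)
    where
    open ≡-Reasoning
    recurrence-at-c : m a (suc (suc c)) + m a c ≡ suc (m (suc (suc c)) b) + m a c
    recurrence-at-c = begin
      m a (suc (suc c)) + m a c            ≡⟨ step (row-recurrence a) a≤c ⟩
      quiddity c * m a (suc c)             ≡⟨ cong (quiddity c *_) ac ⟩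
      quiddity c * 1                       ≡⟨ *-identityʳ (quiddity c) ⟩
      quiddity c                           ≡⟨ split ⟩
      m a c + suc (m (suc (suc c)) b)      ≡⟨ +-comm (m a c) _ ⟩
      suc (m (suc (suc c)) b) + m a c      ∎
    apex-ptolemy : m a (suc (suc c)) ≡ m (suc (suc c)) b + m a b
    apex-ptolemy = begin
      m a (suc (suc c))                                         ≡⟨ *-identityʳ _ ⟨
      m a (suc (suc c)) * 1                                     ≡⟨ cong (m a (suc (suc c)) *_) cb ⟨
      m a (suc (suc c)) * m (suc c) b                           ≡⟨ ptolemy (m≤n⇒m≤1+n a≤c) (n≤1+n (suc c)) c+1<b ⟩
      m a (suc c) * m (suc (suc c)) b + m a b * m (suc c) (suc (suc c))
        ≡⟨ cong₂ (λ u v → u * m (suc (suc c)) b + m a b * v) ac (m-suc (suc c)) ⟩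
      1 * m (suc (suc c)) b + m a b * 1
        ≡⟨ cong₂ _+_ (*-identityˡ (m (suc (suc c)) b)) (*-identityʳ (m a b)) ⟩
      m (suc (suc c)) b + m a b                                 ∎

  ones-not-interleaved : ∀ {a b c d} → m a b ≡ 1 → m c d ≡ 1 → ¬ (a < c × c < b × b < d)
  ones-not-interleaved {a} {b} {c} {d} ab cd (a<c , c<b , b<d) = <⇒≱ (n<1+n 1) (begin
    2                                ≤⟨ +-mono-≤ (*-mono-≤ (positive a c a<c) (positive b d b<d))
                                                 (*-mono-≤ (positive a d a<d) (positive c b c<b)) ⟩
    m a c * m b d + m a d * m c b    ≡⟨ ptolemy (<⇒≤ a<c) (<⇒≤ c<b) (<⇒≤ b<d) ⟨
    m a b * m c d                    ≡⟨ cong₂ _*_ ab cd ⟩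
    1                                ∎)
    where
    open ≤-Reasoning
    a<d : a < d
    a<d = <-trans a<c (<-trans c<b b<d)

  ones-noncrossing : ∀ {a b c d} → m a b ≡ 1 → m c d ≡ 1 → ¬ Cross a b c d
  ones-noncrossing ab cd (inj₁ a<c<b<d) = ones-not-interleaved ab cd a<c<b<d
  ones-noncrossing ab cd (inj₂ c<a<d<b) = ones-not-interleaved cd ab c<a<d<b

module TriangulationProperties {ℓ : Level} {R : ℕ → ℕ → Set ℓ} (T : Triangulation R) where
  open Triangulation T

  Triple : Set
  Triple = ℕ × ℕ × ℕ

  Apex : ℕ → ℕ → Set ℓ
  Apex a b = ∃[ c ] IsTriangle R (a , c , b)

  Star : ℕ → Pred Triple ℓ
  Star v t = IsTriangle R t × HasVertex v t

  LeftFan : ℕ → ℕ → Pred Triple ℓ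
  LeftFan x c (i , j , k) = IsTriangle R (i , j , k) × k ≡ c × x ≤ i

  RightFan : ℕ → ℕ → Pred Triple ℓ
  RightFan c y (i , j , k) = IsTriangle R (i , j , k) × i ≡ c × k ≤ y

  arc-suc : ∀ a → R a (suc a)
  arc-suc a = subst (R a) (+-comm a 1) (contains-succ a)

  star-enumeration : ∀ {v n} → TriangleCount R v n → Σ[ e ∈ Enumeration (Star v) ] size e ≡ n
  star-enumeration (ts , unique , sound , complete , length≡) = record
    { elements = ts
    ; unique   = unique
    ; sound    = All.lookup sound
    ; complete = λ (t , v∈t) → complete _ t v∈t
    } , length≡

  triangle-from-last-arc : ∀ {a b d} → R a b → a < d → d < b → R a d →
                           (∀ {e} → d < e → e < b → ¬ R a e) → IsTriangle R (a , d , b)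
  triangle-from-last-arc {a} {b} {d} Rab a<d d<b Rad last =
    a<d , d<b , Rad , maximal d b d<b uncrossed , Rab
    where
    uncrossed : ∀ x y → R x y → ¬ Cross d b x y
    uncrossed x y Rxy (inj₁ (d<x , x<b , b<y)) = noncross Rab Rxy (inj₁ (<-trans a<d d<x , x<b , b<y))
    uncrossed x y Rxy (inj₂ (x<d , d<y , y<b)) with <-cmp x a
    ... | tri< x<a _ _ = noncross Rab Rxy (inj₂ (x<a , <-trans a<d d<y , y<b))
    ... | tri≈ _ refl _ = last d<y y<b Rxy
    ... | tri> _ _ a<x = noncross Rad Rxy (inj₁ (a<x , x<d , d<y))

  apex-¬¬ : ∀ {a b} → R a b → suc a < b → ¬ ¬ Apex a b
  apex-¬¬ {a} {b} Rab a+1<b no-apex = no-arc-above ≤-refl (≤⇒≤‴ (arc Rab)) (n<1+n a) a+1<b (arc-suc a)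
    where
    no-arc-above : ∀ {c} → a ≤ c → suc c ≤‴ b → ∀ {e} → c < e → e < b → ¬ R a e
    no-arc-above a≤c ≤‴-refl c<e e<b _ = <⇒≱ e<b c<e
    no-arc-above {c} a≤c (≤‴-step c+1<‴b) c<e e<b Rae with m≤n⇒m<n∨m≡n c<e
    ... | inj₁ c+1<e = no-arc-above (m≤n⇒m≤1+n a≤c) c+1<‴b c+1<e e<b Rae
    ... | inj₂ refl  = no-apex (suc c , triangle-from-last-arc Rab (s≤s a≤c) e<b Rae
                                          (no-arc-above (m≤n⇒m≤1+n a≤c) c+1<‴b))

  Spans : ℕ → ℕ → Pred Triple 0ℓ
  Spans a b (i , j , k) = i ≡ a × k ≡ b

  spans? : ∀ a b → Decidable (Spans a b)
  spans? a b (i , j , k) = (i ≟ a) ×-dec (k ≟ b)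

  left-fan-empty : ∀ x → Empty (LeftFan x (suc x))
  left-fan-empty x (i , j , k) ((i<j , j<k , _) , refl , x≤i) = <⇒≱ (≤-<-trans x≤i i<j) (≤-pred j<k)

  right-fan-empty : ∀ c → Empty (RightFan c (suc c))
  right-fan-empty c (i , j , k) ((i<j , j<k , _) , refl , k≤c+1) = <⇒≱ (≤-<-trans i<j j<k) k≤c+1

  left-fan-split : ∀ {x d c} → IsTriangle R (x , d , c) → ｛ (x , d , c) ｝ ∪ LeftFan d c ≐ LeftFan x c
  left-fan-split {x} {d} {c} xdc@(x<d , d<c , Rxd , Rdc , _) = join , split
    where
    join : ｛ (x , d , c) ｝ ∪ LeftFan d c ⊆ LeftFan x c
    join (inj₁ refl)               = xdc , refl , ≤-refl
    join (inj₂ (ijk , k≡c , d≤i)) = ijk , k≡c , ≤-trans (<⇒≤ x<d) d≤i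
    split : LeftFan x c ⊆ ｛ (x , d , c) ｝ ∪ LeftFan d c
    split {i , j , k} ((i<j , j<k , Rij , Rjk , _) , refl , x≤i) with m≤n⇒m<n∨m≡n x≤i
    ... | inj₂ refl with <-cmp j d
    ...   | tri< j<d _ _ = ⊥-elim (noncross Rxd Rjk (inj₁ (i<j , j<d , d<c)))
    ...   | tri≈ _ refl _ = inj₁ refl
    ...   | tri> _ _ d<j = ⊥-elim (noncross Rij Rdc (inj₁ (x<d , d<j , j<k)))
    split {i , j , k} (ijk@(_ , _ , _ , _ , Rik) , refl , x≤i) | inj₁ x<i with d ≤? i
    ... | yes d≤i = inj₂ (ijk , refl , d≤i)
    ... | no d≰i  = ⊥-elim (noncross Rxd Rik (inj₁ (x<i , ≰⇒> d≰i , d<c)))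

  right-fan-split : ∀ {c e y} → IsTriangle R (c , e , y) → ｛ (c , e , y) ｝ ∪ RightFan c e ≐ RightFan c y
  right-fan-split {c} {e} {y} cey@(c<e , e<y , Rce , Rey , _) = join , split
    where
    join : ｛ (c , e , y) ｝ ∪ RightFan c e ⊆ RightFan c y
    join (inj₁ refl)               = cey , refl , ≤-refl
    join (inj₂ (ijk , i≡c , k≤e)) = ijk , i≡c , ≤-trans k≤e (<⇒≤ e<y)
    split : RightFan c y ⊆ ｛ (c , e , y) ｝ ∪ RightFan c e
    split {i , j , k} ((i<j , j<k , Rij , Rjk , _) , refl , k≤y) with m≤n⇒m<n∨m≡n k≤y
    ... | inj₂ refl with <-cmp j e
    ...   | tri< j<e _ _ = ⊥-elim (noncross Rce Rjk (inj₁ (i<j , j<e , e<y)))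
    ...   | tri≈ _ refl _ = inj₁ refl
    ...   | tri> _ _ e<j = ⊥-elim (noncross Rij Rey (inj₁ (c<e , e<j , j<k)))
    split {i , j , k} (ijk@(_ , _ , _ , _ , Rik) , refl , k≤y) | inj₁ k<y with k ≤? e
    ... | yes k≤e = inj₂ (ijk , refl , k≤e)
    ... | no k≰e  = ⊥-elim (noncross Rik Rey (inj₁ (c<e , ≰⇒> k≰e , k<y)))

  star-split : ∀ {a c b} → IsTriangle R (a , c , b) →
               LeftFan a c ∪ (｛ (a , c , b) ｝ ∪ RightFan c b) ≐ Star c
  star-split {a} {c} {b} acb@(a<c , c<b , Rac , Rcb , Rab) = join , split
    where
    join : LeftFan a c ∪ (｛ (a , c , b) ｝ ∪ RightFan c b) ⊆ Star c
    join (inj₁ (ijk , k≡c , _))         = ijk , inj₂ (inj₂ (sym k≡c))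
    join (inj₂ (inj₁ refl))             = acb , inj₂ (inj₁ refl)
    join (inj₂ (inj₂ (ijk , i≡c , _))) = ijk , inj₁ (sym i≡c)
    split : Star c ⊆ LeftFan a c ∪ (｛ (a , c , b) ｝ ∪ RightFan c b)
    split {i , j , k} (ijk@(_ , _ , _ , _ , Rik) , inj₁ refl) with k ≤? b
    ... | yes k≤b = inj₂ (inj₂ (ijk , refl , k≤b))
    ... | no k≰b  = ⊥-elim (noncross Rab Rik (inj₁ (a<c , c<b , ≰⇒> k≰b)))
    split {i , j , k} ((i<j , j<k , Rij , Rjk , Rik) , inj₂ (inj₁ refl)) with <-cmp i a
    ... | tri< i<a _ _ = ⊥-elim (noncross Rab Rij (inj₂ (i<a , a<c , c<b)))
    ... | tri> _ _ a<i = ⊥-elim (noncross Rac Rik (inj₁ (a<i , i<j , j<k)))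
    ... | tri≈ _ refl _ with <-cmp k b
    ...   | tri< k<b _ _ = ⊥-elim (noncross Rcb Rik (inj₂ (i<j , j<k , k<b)))
    ...   | tri≈ _ refl _ = inj₂ (inj₁ refl)
    ...   | tri> _ _ b<k = ⊥-elim (noncross Rab Rjk (inj₁ (a<c , c<b , b<k)))
    split {i , j , k} (ijk@(_ , _ , _ , _ , Rik) , inj₂ (inj₂ refl)) with a ≤? i
    ... | yes a≤i = inj₁ (ijk , refl , a≤i)
    ... | no a≰i  = ⊥-elim (noncross Rab Rik (inj₂ (≰⇒> a≰i , a<c , c<b)))

module HalfFriezeFromTriangulation {ℓ : Level} {R : ℕ → ℕ → Set ℓ} {m : ℕ → ℕ → ℕ}
                                   (T : Triangulation R) (HF : HalfFriezeFrom R m) where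
  open Triangulation T
  open TriangulationProperties T
  open HalfFriezeFrom HF using (frieze)
  open RightHalfFrieze frieze using (diag)
  open RightHalfFriezeProperties frieze

  star : ∀ c → Σ[ e ∈ Enumeration (Star (suc c)) ] size e ≡ quiddity c
  star c = star-enumeration (subst₂ (λ v n → TriangleCount R v (m c n)) (+-comm c 1) (+-comm c 2)
                                    (HalfFriezeFrom.quiddity HF c))

  -- apex-¬¬ only gives the apex classically; searching the finite star of b produces it.
  apex : ∀ {a b} → R a b → suc a < b → Apex a b
  apex {a} {suc b} Rab a+1<b with star b
  ... | star-b , _ with any? (spans? a (suc b)) (elements star-b)
  ...   | no none = ⊥-elim (apex-¬¬ Rab a+1<b λ (c , acb) →
                      none (lose (complete star-b (acb , inj₂ (inj₂ refl))) (refl , refl)))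
  ...   | yes found with find found
  ...     | (_ , c , _) , t∈ , refl , refl = c , proj₁ (sound star-b t∈)

  ArcsInside : ℕ → ℕ → Set ℓ
  ArcsInside x y = ∀ {u v} → R u v → x ≤ u → v ≤ y → m u v ≡ 1

  arcsInside-shrink : ∀ {x y x′ y′} → x ≤ x′ → y′ ≤ y → ArcsInside x y → ArcsInside x′ y′
  arcsInside-shrink x≤x′ y′≤y ones Ruv x′≤u v≤y′ = ones Ruv (≤-trans x≤x′ x′≤u) (≤-trans v≤y′ y′≤y)

  left-fan : ∀ {x c} → Acc _<_ (c ∸ x) → R x (suc c) → ArcsInside x (suc c) →
             Σ[ e ∈ Enumeration (LeftFan x (suc c)) ] size e ≡ m x c
  left-fan {x} {c} (acc rs) Rxc ones with m≤n⇒m<n∨m≡n (≤-pred (arc Rxc))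
  ... | inj₂ refl = enumeration-∅ (left-fan-empty x) , sym (diag x)
  ... | inj₁ x<c with apex Rxc (s≤s x<c)
  ...   | d , xdc@(x<d , d<c+1 , Rxd , Rdc , _) =
    enumeration-≐ (left-fan-split xdc) (enumeration-∪ disjoint (enumeration-｛｝ _) (proj₁ inner)) ,
    (begin
      suc (size (proj₁ inner))  ≡⟨ cong suc (proj₂ inner) ⟩
      suc (m d c)               ≡⟨ left-fan-step (<⇒≤ x<d) d≤c (ones Rxd ≤-refl (<⇒≤ d<c+1))
                                                 (ones Rdc (<⇒≤ x<d) ≤-refl) (ones Rxc ≤-refl ≤-refl) ⟨
      m x c                     ∎)
    where
    open ≡-Reasoning
    d≤c : d ≤ c
    d≤c = ≤-pred d<c+1
    inner : Σ[ e ∈ Enumeration (LeftFan d (suc c)) ] size e ≡ m d c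
    inner = left-fan (rs (∸-monoʳ-< x<d d≤c)) Rdc (arcsInside-shrink (<⇒≤ x<d) ≤-refl ones)
    disjoint : Empty (｛ (x , d , suc c) ｝ ∩ LeftFan d (suc c))
    disjoint _ (refl , _ , _ , d≤x) = <⇒≱ x<d d≤x

  right-fan : ∀ {c y} → Acc _<_ y → R c y → ArcsInside c y →
              Σ[ e ∈ Enumeration (RightFan c y) ] size e ≡ m (suc c) y
  right-fan {c} {y} (acc rs) Rcy ones with m≤n⇒m<n∨m≡n (arc Rcy)
  ... | inj₂ refl = enumeration-∅ (right-fan-empty c) , sym (diag (suc c))
  ... | inj₁ c+1<y with apex Rcy c+1<y
  ...   | e , cey@(c<e , e<y , Rce , Rey , _) =
    enumeration-≐ (right-fan-split cey) (enumeration-∪ disjoint (enumeration-｛｝ _) (proj₁ inner)) ,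
    (begin
      suc (size (proj₁ inner))  ≡⟨ cong suc (proj₂ inner) ⟩
      suc (m (suc c) e)         ≡⟨ right-fan-step c<e (<⇒≤ e<y) (ones Rce ≤-refl (<⇒≤ e<y))
                                                  (ones Rey (<⇒≤ c<e) ≤-refl) (ones Rcy ≤-refl ≤-refl) ⟨
      m (suc c) y               ∎)
    where
    open ≡-Reasoning
    inner : Σ[ e′ ∈ Enumeration (RightFan c e) ] size e′ ≡ m (suc c) e
    inner = right-fan (rs e<y) Rce (arcsInside-shrink ≤-refl (<⇒≤ e<y) ones)
    disjoint : Empty (｛ (c , e , y) ｝ ∩ RightFan c e)
    disjoint _ (refl , _ , _ , y≤e) = <⇒≱ e<y y≤e

  arc⇒one-acc : ∀ {a b} → Acc _<_ (b ∸ a) → R a b → m a b ≡ 1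
  arc⇒one-acc {a} {b} (acc rs) Rab with m≤n⇒m<n∨m≡n (arc Rab)
  ... | inj₂ refl = m-suc a
  ... | inj₁ a+1<b with apex Rab a+1<b
  ...   | zero , (() , _)
  ...   | suc c , acb@(a<c+1 , c+1<b , Rac , Rcb , _) =
    long-side-one (≤-pred a<c+1) c+1<b (inside left-shorter Rac ≤-refl ≤-refl)
                  (inside right-shorter Rcb ≤-refl ≤-refl) quiddity-split
    where
    open ≡-Reasoning
    inside : ∀ {x y} → y ∸ x < b ∸ a → ArcsInside x y
    inside shorter Ruv x≤u v≤y = arc⇒one-acc (rs (≤-<-trans (∸-mono v≤y x≤u) shorter)) Ruv
    left-shorter : suc c ∸ a < b ∸ a
    left-shorter = ∸-monoˡ-< c+1<b (<⇒≤ a<c+1)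
    right-shorter : b ∸ suc c < b ∸ a
    right-shorter = ∸-monoʳ-< a<c+1 (<⇒≤ c+1<b)
    left : Σ[ e ∈ Enumeration (LeftFan a (suc c)) ] size e ≡ m a c
    left = left-fan (<-wellFounded _) Rac (inside left-shorter)
    right : Σ[ e ∈ Enumeration (RightFan (suc c) b) ] size e ≡ m (suc (suc c)) b
    right = right-fan (<-wellFounded _) Rcb (inside right-shorter)
    apex-disjoint : Empty (｛ (a , suc c , b) ｝ ∩ RightFan (suc c) b)
    apex-disjoint _ (refl , _ , a≡c+1 , _) = <⇒≢ a<c+1 a≡c+1
    left-disjoint : Empty (LeftFan a (suc c) ∩ (｛ (a , suc c , b) ｝ ∪ RightFan (suc c) b))
    left-disjoint _ ((_ , b≡c+1 , _) , inj₁ refl) = <⇒≢ c+1<b (sym b≡c+1)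
    left-disjoint _ (((i<j , j<k , _) , refl , _) , inj₂ (_ , refl , _)) = <-irrefl refl (<-trans i<j j<k)
    pieces : Enumeration (LeftFan a (suc c) ∪ (｛ (a , suc c , b) ｝ ∪ RightFan (suc c) b))
    pieces = enumeration-∪ left-disjoint (proj₁ left)
               (enumeration-∪ apex-disjoint (enumeration-｛｝ _) (proj₁ right))
    quiddity-split : quiddity c ≡ m a c + suc (m (suc (suc c)) b)
    quiddity-split = begin
      quiddity c                                      ≡⟨ proj₂ (star c) ⟨
      size (proj₁ (star c))                           ≡⟨ size-≐ (star-split acb) pieces (proj₁ (star c)) ⟨
      size pieces                                     ≡⟨ length-++ (elements (proj₁ left)) ⟩
      size (proj₁ left) + suc (size (proj₁ right))    ≡⟨ cong₂ (λ l r → l + suc r) (proj₂ left) (proj₂ right) ⟩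
      m a c + suc (m (suc (suc c)) b)                 ∎

  arc⇒one : ∀ {a b} → R a b → m a b ≡ 1
  arc⇒one = arc⇒one-acc (<-wellFounded _)

  one⇒arc : ∀ {a b} → a < b → m a b ≡ 1 → R a b
  one⇒arc {a} {b} a<b ab = maximal a b a<b λ c d Rcd → ones-noncrossing ab (arc⇒one Rcd)

lemma3p23 : ∀ {ℓ : Level} (R : ℕ → ℕ → Set ℓ) (m : ℕ → ℕ → ℕ) →
    RightFountain0 R → HalfFriezeFrom R m →
    ∀ a b → a < b → (m a b ≡ 1) ⇔ R a b
lemma3p23 R m RF HF a b a<b = mk⇔ (one⇒arc a<b) arc⇒one
  where open HalfFriezeFromTriangulation (RightFountain0.triangulation RF) HF
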